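{- Let $k\ge1$, let $B=\{b_1,\dots,b_k\}$ be a set of positive integers and $\mathbf{S}=(S_1,\dots,S_k)$ a $k$-tuple of finite nonempty subsets of $\{0,1,2,\dots\}$, assume $\Lambda(\mathcal{K})\neq\emptyset$, and let $\varepsilon\in\{ -1,1\}$. If $p\in\Pi_-(B,\mathbf{S})$, then $q_\varepsilon(p)=0$, where \[ q_\varepsilon(p)=\big|\{A\in AP(B,\mathbf{S}): A\subseteq[1,p-1],\ \chi_p(a)=\varepsilon\text{ for all }a\in A\}\big|,\qquad AP(B,\mathbf{S})=\Big\{\bigcup_{i=1}^k(b_in+S_i): n\ge1\Big\}. \]
   Context: $b_in+S_i=\{b_in+x:x\in S_i\}$; $[1,p-1]=\{1,\dots,p-1\}$; $\chi_p$ is the Legendre symbol of the odd prime $p$. For $b$ a positive integer and $S\subseteq\mathbb{Z}$, $b^{ -1}S=\{z/b:z\in S\}$. Let $\mathcal{K}=\{\emptyset\ne K\subseteq\{1,\dots,k\}: \bigcap_{i\in K}b_i^{ -1}S_i\ne\emptyset\}$; for $K\in\mathcal{K}$, $T(K)=\big(\bigcap_{i\in K}b_i^{ -1}S_i\big)\cap\big(\bigcap_{i\notin K}(\mathbb{Q}\setminus b_i^{ -1}S_i)\big)$; $\mathcal{K}_{\max}=\{K\in\mathcal{K}:T(K)\ne\emptyset\}$; $\mathcal{E}(X)$ is the set of nonempty even-cardinality subsets of a finite set $X$; $\Lambda(\mathcal{K})=\bigcup_{K\in\mathcal{K}_{\max}}\mathcal{E}(K)$. An allowable prime is an odd prime dividing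 no $b_i$. $\Pi_-(B,\mathbf{S})$ is the set of allowable primes $p$ such that $\chi_p(\prod_{i\in I}b_i)=-1$ for at least one $I\in\Lambda(\mathcal{K})$. -}

module Defs where

open import Data.Nat using (ℕ; zero; suc; _+_; _*_; _∸_; _%_; _≤_)
open import Data.Nat.Divisibility using (_∣_; _∣?_)
open import Data.Nat.Primality using (Prime)
open import Data.Integer using (ℤ; +_; 0ℤ; 1ℤ; -1ℤ)
open import Data.Rational as ℚ using (ℚ; _/_)
open import Data.Fin using (Fin; toℕ) renaming (zero to fzero; suc to fsuc)
open import Data.Fin.Properties using (any?)
open import Data.Fin.Subset using (Subset; _∈_; _∉_; _⊆_; ∣_∣; Nonempty)
open import Data.Vec using (Vec; []; _∷_)
open import Data.Bool using (true; false)
open import Data.List using (List)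
import Data.List.Membership.Propositional as L
open import Data.Product using (Σ; ∃; _×_; _,_)
open import Relation.Binary.PropositionalEquality using (_≡_)
open import Relation.Nullary using (¬_; Dec; yes; no)
import Data.Nat as ℕ

IsSqMod : (m' : ℕ) → ℕ → Set
IsSqMod m' a = ∃ λ (x : Fin (suc m')) → (toℕ x * toℕ x) % suc m' ≡ a % suc m'

isSqMod? : (m' : ℕ) (a : ℕ) → Dec (IsSqMod m' a)
isSqMod? m' a = any? (λ x → (toℕ x * toℕ x) % suc m' ℕ.≟ a % suc m')

-- Legendre symbol χ_p(a) (meaningful for p an odd prime; p = 0 is junk).
legendre : ℕ → ℕ → ℤ
legendre zero a = 0ℤ
legendre (suc m') a with suc m' ∣? a
... | yes _ = 0ℤ
... | no _ with isSqMod? m' a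
...   | yes _ = 1ℤ
...   | no _ = -1ℤ

-- r ∈ b⁻¹ S, i.e. r = z / b for some z ∈ S (b > 0), written as r·b = z.
InScaled : ℕ → List ℕ → ℚ → Set
InScaled b S r = ∃ λ z → z L.∈ S × r ℚ.* ((+ b) / 1) ≡ (+ z) / 1

module Setup {k : ℕ} (b : Fin k → ℕ) (S : Fin k → List ℕ) where

  InCalK : Subset k → Set
  InCalK K = Nonempty K × ∃ λ (r : ℚ) → ∀ i → i ∈ K → InScaled (b i) (S i) r

  InT : Subset k → ℚ → Set
  InT K r = (∀ i → i ∈ K → InScaled (b i) (S i) r)
          × (∀ i → i ∉ K → ¬ InScaled (b i) (S i) r)

  InKmax : Subset k → Set
  InKmax K = InCalK K × ∃ λ r → InT K r

  InΛ : Subset k → Set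
  InΛ I = ∃ λ K → InKmax K × I ⊆ K × Nonempty I × 2 ∣ ∣ I ∣

  InAP : ℕ → ℕ → Set
  InAP n a = ∃ λ (i : Fin k) → ∃ λ x → x L.∈ S i × a ≡ b i * n + x

prodOver : ∀ {k} → (Fin k → ℕ) → Subset k → ℕ
prodOver b [] = 1
prodOver b (true ∷ I) = b fzero * prodOver (λ i → b (fsuc i)) I
prodOver b (false ∷ I) = prodOver (λ i → b (fsuc i)) I

Allowable : ∀ {k} → (Fin k → ℕ) → ℕ → Set
Allowable b p = Prime p × ¬ (2 ∣ p) × (∀ i → ¬ (p ∣ b i))

InΠminus : ∀ {k} → (Fin k → ℕ) → (Fin k → List ℕ) → ℕ → Set
InΠminus b S p = Allowable b p ×
  ∃ λ I → Setup.InΛ b S I × legendre p (prodOver b I) ≡ -1ℤ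

-- For i ∈ K pick z_i ∈ S_i with z_i = b_i r.  Then a_i = b_i n + z_i lies in the progression and
-- a_i / b_i = n + r does not depend on i, so a_i b_j = b_i a_j.  If every member of the progression
-- has Legendre symbol ε, multiplicativity gives χ_p(b_i) = χ_p(b_j) for i, j ∈ I, so
-- χ_p(∏_{i∈I} b_i) is an even power of ±1, i.e. 1, contradicting p ∈ Π₋.
-- Multiplicativity reduces to "a product of two non-residues is a residue": were u, v and uv all
-- non-residues modulo p = 2h + 1, then 0 and the numbers x², u x², uv x² (1 ≤ x ≤ h) would be
-- 3h + 1 pairwise incongruent residues, forcing h = 0.
module Submission where

open import Defs
open import Data.Nat using (ℕ; zero; suc; _+_; _*_; _∸_; _%_; _/_; _≤_; _<_; s≤s)
open import Data.Nat.Properties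
open import Data.Nat.DivMod using (_mod_; m≡m%n+[m/n]*n; m%n<n; m%n%n≡m%n; %-distribˡ-*; [m+kn]%n≡m%n; [m+n]%n≡m%n)
open import Data.Nat.Divisibility using (_∣_; _∣?_; divides; >⇒∤; ∣1⇒≡1; ∣-refl; ∣m∣n⇒∣m+n; ∣m⇒∣m*n; m%n≡0⇒n∣m; n∣m⇒m%n≡0)
open import Data.Nat.Primality using (Prime; euclidsLemma; prime⇒irreducible; ¬prime[0]; ¬prime[1])
open import Data.Nat.Coprimality using (Coprime; coprime-Bézout; 1-coprimeTo) renaming (sym to coprime-sym)
open import Data.Nat.GCD using (module Bézout)
open import Data.Nat.Tactic.RingSolver using (solve-∀)
open import Data.Integer using (ℤ; +_; 1ℤ; -1ℤ)
import Data.Integer as ℤ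
import Data.Integer.Properties as ℤ
open import Data.Rational as ℚ using (ℚ; mkℚ)
import Data.Rational.Properties as ℚ
open import Data.Fin using (Fin; toℕ; combine; remQuot) renaming (suc to fsuc)
open import Data.Fin.Patterns using (0F; 1F; 2F)
open import Data.Fin.Properties using (toℕ-fromℕ<; toℕ<n; toℕ-injective; injective⇒≤; combine-remQuot)
open import Data.Fin.Subset using (Subset; _∈_; ∣_∣)
open import Data.Vec using ([]; _∷_; here; there)
open import Data.Bool using (true; false)
open import Data.List using (List; [])
open import Data.Product using (∃; _×_; _,_; uncurry)
open import Data.Sum using (_⊎_; inj₁; inj₂)
open import Data.Empty using (⊥-elim)
open import Function using (_∘_)
open import Function.Definitions using (Injective)
open import Relation.Binary.Bundles using (Setoid)
open import Relation.Binary.Structures using (IsEquivalence)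
open import Relation.Binary.PropositionalEquality
open import Relation.Nullary using (¬_; Dec; yes; no)

odd⇒pred≡double : ∀ {n} → ¬ 2 ∣ suc n → ∃ λ h → n ≡ h + h
odd⇒pred≡double {zero}        _   = 0 , refl
odd⇒pred≡double {suc zero}    odd = ⊥-elim (odd ∣-refl)
odd⇒pred≡double {suc (suc n)} odd with odd⇒pred≡double {n} (λ 2∣n+1 → odd (∣m∣n⇒∣m+n ∣-refl 2∣n+1))
... | h , n≡h+h = suc h , cong suc (trans (cong suc n≡h+h) (sym (+-suc h h)))

3*n≤n+n⇒n≡0 : ∀ n → 3 * n ≤ n + n → n ≡ 0
3*n≤n+n⇒n≡0 n 3n≤2n = n≤0⇒n≡0 (+-cancelʳ-≤ (n + n) n 0
  (subst (_≤ n + n) (cong (λ t → n + (n + t)) (+-identityʳ n)) 3n≤2n))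

IsUnit : ℤ → Set
IsUnit σ = σ ≡ -1ℤ ⊎ σ ≡ 1ℤ

unit-cancelˡ : ∀ {ε s t} → IsUnit ε → ε ℤ.* s ≡ ε ℤ.* t → s ≡ t
unit-cancelˡ {s = s} {t} (inj₁ refl) = ℤ.*-cancelˡ-≡ -1ℤ s t
unit-cancelˡ {s = s} {t} (inj₂ refl) = ℤ.*-cancelˡ-≡ 1ℤ s t

unit-even-power : ∀ {σ n} → IsUnit σ → 2 ∣ n → σ ℤ.^ n ≡ 1ℤ
unit-even-power {σ} σ-unit (divides q refl) = begin
  σ ℤ.^ (q * 2)        ≡⟨ cong (σ ℤ.^_) (*-comm q 2) ⟩
  σ ℤ.^ (2 * q)        ≡⟨ ℤ.^-*-assoc σ 2 q ⟨
  (σ ℤ.^ 2) ℤ.^ q      ≡⟨ cong (ℤ._^ q) (square≡1 σ-unit) ⟩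
  1ℤ ℤ.^ q             ≡⟨ ℤ.^-zeroˡ q ⟩
  1ℤ                   ∎
  where
    open ≡-Reasoning
    square≡1 : ∀ {σ} → IsUnit σ → σ ℤ.^ 2 ≡ 1ℤ
    square≡1 (inj₁ refl) = refl
    square≡1 (inj₂ refl) = refl

fromℕ : ℕ → ℚ
fromℕ n = + n ℚ./ 1

fromℕ≡mkℚ : ∀ n → fromℕ n ≡ mkℚ (+ n) 0 (coprime-sym (1-coprimeTo n))
fromℕ≡mkℚ n = ℚ.normalize-coprime (coprime-sym (1-coprimeTo n))

fromℕ-* : ∀ m n → fromℕ m ℚ.* fromℕ n ≡ fromℕ (m * n)
fromℕ-* m n = trans (cong₂ ℚ._*_ (fromℕ≡mkℚ m) (fromℕ≡mkℚ n)) (cong (ℚ._/ 1) (sym (ℤ.pos-* m n)))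

fromℕ-injective : ∀ {m n} → fromℕ m ≡ fromℕ n → m ≡ n
fromℕ-injective {m} {n} eq =
  ℤ.+-injective (cong ℚ.numerator (trans (sym (fromℕ≡mkℚ m)) (trans eq (fromℕ≡mkℚ n))))

common-ratio⇒cross : ∀ {r b z b′ z′} → r ℚ.* fromℕ b ≡ fromℕ z → r ℚ.* fromℕ b′ ≡ fromℕ z′ →
                     z * b′ ≡ z′ * b
common-ratio⇒cross {r} {b} {z} {b′} {z′} rb≡z rb′≡z′ = fromℕ-injective (begin
  fromℕ (z * b′)                   ≡⟨ fromℕ-* z b′ ⟨
  fromℕ z ℚ.* fromℕ b′             ≡⟨ cong (ℚ._* fromℕ b′) rb≡z ⟨
  (r ℚ.* fromℕ b) ℚ.* fromℕ b′     ≡⟨ ℚ.*-assoc r (fromℕ b) (fromℕ b′) ⟩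
  r ℚ.* (fromℕ b ℚ.* fromℕ b′)     ≡⟨ cong (r ℚ.*_) (ℚ.*-comm (fromℕ b) (fromℕ b′)) ⟩
  r ℚ.* (fromℕ b′ ℚ.* fromℕ b)     ≡⟨ ℚ.*-assoc r (fromℕ b′) (fromℕ b) ⟨
  (r ℚ.* fromℕ b′) ℚ.* fromℕ b     ≡⟨ cong (ℚ._* fromℕ b) rb′≡z′ ⟩
  fromℕ z′ ℚ.* fromℕ b             ≡⟨ fromℕ-* z′ b ⟩
  fromℕ (z′ * b)                   ∎)
  where open ≡-Reasoning

shift-proportional : ∀ b z b′ z′ n → z * b′ ≡ z′ * b → (b * n + z) * b′ ≡ b * (b′ * n + z′)
shift-proportional b z b′ z′ n zb′≡z′b = begin
  (b * n + z) * b′        ≡⟨ expand b n z b′ ⟩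
  b * n * b′ + z * b′     ≡⟨ cong (_+_ (b * n * b′)) zb′≡z′b ⟩
  b * n * b′ + z′ * b     ≡⟨ collect b n b′ z′ ⟩
  b * (b′ * n + z′)       ∎
  where
    open ≡-Reasoning
    expand : ∀ b n z b′ → (b * n + z) * b′ ≡ b * n * b′ + z * b′
    expand = solve-∀
    collect : ∀ b n b′ z′ → b * n * b′ + z′ * b ≡ b * (b′ * n + z′)
    collect = solve-∀

-- The modulus is written suc m so that _%_, and legendre from Defs, compute on it.
module Congruence (m : ℕ) where

  p : ℕ
  p = suc m

  infix 4 _≈_
  record _≈_ (a b : ℕ) : Set where
    constructor mk≈
    field %-≡ : a % p ≡ b % p

  ≈-isEquivalence : IsEquivalence _≈_
  ≈-isEquivalence = record
    { refl  = mk≈ refl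
    ; sym   = λ { (mk≈ e) → mk≈ (sym e) }
    ; trans = λ { (mk≈ e) (mk≈ f) → mk≈ (trans e f) }
    }

  ≈-setoid : Setoid _ _
  ≈-setoid = record { isEquivalence = ≈-isEquivalence }

  open IsEquivalence ≈-isEquivalence public
    using () renaming (refl to ≈-refl; sym to ≈-sym; trans to ≈-trans; reflexive to ≈-reflexive)

  *-cong : ∀ {a a′ b b′} → a ≈ a′ → b ≈ b′ → a * b ≈ a′ * b′
  *-cong {a} {a′} {b} {b′} (mk≈ e) (mk≈ f) = mk≈ (begin
    (a * b) % p             ≡⟨ %-distribˡ-* a b p ⟩
    (a % p * (b % p)) % p   ≡⟨ cong₂ (λ x y → (x * y) % p) e f ⟩
    (a′ % p * (b′ % p)) % p ≡⟨ %-distribˡ-* a′ b′ p ⟨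
    (a′ * b′) % p           ∎)
    where open ≡-Reasoning

  %-≈ : ∀ a → a % p ≈ a
  %-≈ a = mk≈ (m%n%n≡m%n a p)

  ∣⇒≈0 : ∀ {a} → p ∣ a → a ≈ 0
  ∣⇒≈0 {a} p∣a = mk≈ (n∣m⇒m%n≡0 a p p∣a)

  ≈0⇒∣ : ∀ {a} → a ≈ 0 → p ∣ a
  ≈0⇒∣ {a} (mk≈ e) = m%n≡0⇒n∣m a p e

  +-≈⇒∣ : ∀ a d → a + d ≈ a → p ∣ d
  +-≈⇒∣ a d (mk≈ e) = divides ((a + d) / p ∸ a / p) (begin
    d                                                   ≡⟨ m+n∸m≡n a d ⟨
    (a + d) ∸ a                                         ≡⟨ cong₂ _∸_ (m≡m%n+[m/n]*n (a + d) p) (m≡m%n+[m/n]*n a p) ⟩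
    ((a + d) % p + (a + d) / p * p) ∸ (a % p + a / p * p)
      ≡⟨ cong (λ r → ((a + d) % p + (a + d) / p * p) ∸ (r + a / p * p)) e ⟨
    ((a + d) % p + (a + d) / p * p) ∸ ((a + d) % p + a / p * p)
      ≡⟨ [m+n]∸[m+o]≡n∸o ((a + d) % p) ((a + d) / p * p) (a / p * p) ⟩
    (a + d) / p * p ∸ a / p * p                         ≡⟨ *-distribʳ-∸ p ((a + d) / p) (a / p) ⟨
    ((a + d) / p ∸ a / p) * p                           ∎)
    where open ≡-Reasoning

  ∣∧<⇒≡0 : ∀ {a} → p ∣ a → a < p → a ≡ 0
  ∣∧<⇒≡0 {zero}  _   _   = refl
  ∣∧<⇒≡0 {suc a} p∣a a<p = ⊥-elim (>⇒∤ a<p p∣a)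

  incongruent⇒≤ : ∀ {n} (f : Fin n → ℕ) → (∀ {i j} → f i ≈ f j → i ≡ j) → n ≤ p
  incongruent⇒≤ f f-inj = injective⇒≤ {f = λ i → f i mod p} λ {i} {j} e → f-inj (mk≈ (begin
    f i % p           ≡⟨ toℕ-fromℕ< (m%n<n (f i) p) ⟨
    toℕ (f i mod p)   ≡⟨ cong toℕ e ⟩
    toℕ (f j mod p)   ≡⟨ toℕ-fromℕ< (m%n<n (f j) p) ⟩
    f j % p           ∎))
    where open ≡-Reasoning

module PrimeModulus {m : ℕ} (prime : Prime (suc m)) where

  open Congruence m

  p∤1 : ¬ p ∣ 1
  p∤1 p∣1 = ¬prime[1] (subst Prime (∣1⇒≡1 p∣1) prime)

  ∤-* : ∀ {a b} → ¬ p ∣ a → ¬ p ∣ b → ¬ p ∣ a * b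
  ∤-* {a} {b} p∤a p∤b p∣ab with euclidsLemma a b prime p∣ab
  ... | inj₁ p∣a = p∤a p∣a
  ... | inj₂ p∣b = p∤b p∣b

  ∤⇒coprime : ∀ {a} → ¬ p ∣ a → Coprime p a
  ∤⇒coprime p∤a (d∣p , d∣a) with prime⇒irreducible prime d∣p
  ... | inj₁ d≡1 = d≡1
  ... | inj₂ refl = ⊥-elim (p∤a d∣a)

  ∤⇒invertible : ∀ {a} → ¬ p ∣ a → ∃ λ a⁻¹ → a * a⁻¹ ≈ 1
  ∤⇒invertible {a} p∤a with coprime-Bézout (∤⇒coprime p∤a)
  ... | Bézout.-+ x y eq = y , mk≈ (begin
    (a * y) % p     ≡⟨ cong (_% p) (trans (*-comm a y) (sym eq)) ⟩
    (1 + x * p) % p ≡⟨ [m+kn]%n≡m%n 1 x p ⟩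
    1 % p           ∎)
    where open ≡-Reasoning
  -- here 1 + y a = x p, so -y, represented by y m, is the inverse
  ... | Bézout.+- x y eq = y * m , mk≈ (begin
    (a * (y * m)) % p         ≡⟨ [m+n]%n≡m%n (a * (y * m)) p ⟨
    (a * (y * m) + p) % p     ≡⟨ cong (_% p) (shift a y m) ⟩
    (1 + (1 + y * a) * m) % p ≡⟨ cong (λ t → (1 + t * m) % p) eq ⟩
    (1 + x * p * m) % p       ≡⟨ cong (λ t → (1 + t) % p) (swap x p m) ⟩
    (1 + x * m * p) % p       ≡⟨ [m+kn]%n≡m%n 1 (x * m) p ⟩
    1 % p                     ∎)
    where
      open ≡-Reasoning
      shift : ∀ a y m → a * (y * m) + suc m ≡ 1 + (1 + y * a) * m
      shift = solve-∀
      swap : ∀ x p m → x * p * m ≡ x * m * p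
      swap = solve-∀

  *-cancelˡ-≈ : ∀ {c a b} → ¬ p ∣ c → c * a ≈ c * b → a ≈ b
  *-cancelˡ-≈ {c} {a} {b} p∤c ca≈cb with ∤⇒invertible p∤c
  ... | c⁻¹ , cc⁻¹≈1 = begin
    a               ≡⟨ *-identityˡ a ⟨
    1 * a           ≈⟨ *-cong cc⁻¹≈1 ≈-refl ⟨
    c * c⁻¹ * a     ≡⟨ regroup c c⁻¹ a ⟩
    c⁻¹ * (c * a)   ≈⟨ *-cong (≈-refl {c⁻¹}) ca≈cb ⟩
    c⁻¹ * (c * b)   ≡⟨ regroup c c⁻¹ b ⟨
    c * c⁻¹ * b     ≈⟨ *-cong cc⁻¹≈1 ≈-refl ⟩
    1 * b           ≡⟨ *-identityˡ b ⟩
    b               ∎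
    where
      open import Relation.Binary.Reasoning.Setoid ≈-setoid
      regroup : ∀ c d a → c * d * a ≡ d * (c * a)
      regroup = solve-∀

  Square : ℕ → Set
  Square a = ∃ λ x → x * x ≈ a

  square-resp : ∀ {a b} → a ≈ b → Square a → Square b
  square-resp a≈b (x , x²≈a) = x , ≈-trans x²≈a a≈b

  square-* : ∀ {a b} → Square a → Square b → Square (a * b)
  square-* (x , x²≈a) (y , y²≈b) =
    x * y , ≈-trans (≈-reflexive (interchange x y)) (*-cong x²≈a y²≈b)
    where
      interchange : ∀ x y → (x * y) * (x * y) ≡ (x * x) * (y * y)
      interchange = solve-∀

  square-*-comm : ∀ a b → Square (a * b) → Square (b * a)
  square-*-comm a b = square-resp (≈-reflexive (*-comm a b))

  square-*-cancelˡ : ∀ {a b} → ¬ p ∣ a → Square a → Square (a * b) → Square b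
  square-*-cancelˡ {a} {b} p∤a (x , x²≈a) (y , y²≈ab) with ∤⇒invertible p∤x
    where
      p∤x : ¬ p ∣ x
      p∤x p∣x = p∤a (≈0⇒∣ (≈-trans (≈-sym x²≈a) (∣⇒≈0 (∣m⇒∣m*n x p∣x))))
  ... | x⁻¹ , xx⁻¹≈1 = y * x⁻¹ , (begin
    (y * x⁻¹) * (y * x⁻¹)       ≡⟨ regroup y x⁻¹ ⟩
    (y * y) * (x⁻¹ * x⁻¹)       ≈⟨ *-cong y²≈ab ≈-refl ⟩
    (a * b) * (x⁻¹ * x⁻¹)       ≈⟨ *-cong (*-cong x²≈a ≈-refl) ≈-refl ⟨
    ((x * x) * b) * (x⁻¹ * x⁻¹) ≡⟨ regroup′ x x⁻¹ b ⟩
    ((x * x⁻¹) * (x * x⁻¹)) * b ≈⟨ *-cong (*-cong xx⁻¹≈1 xx⁻¹≈1) ≈-refl ⟩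
    1 * b                       ≡⟨ *-identityˡ b ⟩
    b                           ∎)
    where
      open import Relation.Binary.Reasoning.Setoid ≈-setoid
      regroup : ∀ y z → (y * z) * (y * z) ≡ (y * y) * (z * z)
      regroup = solve-∀
      regroup′ : ∀ x z b → ((x * x) * b) * (z * z) ≡ ((x * z) * (x * z)) * b
      regroup′ = solve-∀

  square⇒isSqMod : ∀ {a} → Square a → IsSqMod m a
  square⇒isSqMod {a} (x , x²≈a) = x mod p , (begin
    (toℕ (x mod p) * toℕ (x mod p)) % p ≡⟨ cong (λ t → (t * t) % p) (toℕ-fromℕ< (m%n<n x p)) ⟩
    (x % p * (x % p)) % p               ≡⟨ _≈_.%-≡ (≈-trans (*-cong (%-≈ x) (%-≈ x)) x²≈a) ⟩
    a % p                               ∎)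
    where open ≡-Reasoning

  isSqMod⇒square : ∀ {a} → IsSqMod m a → Square a
  isSqMod⇒square (x , e) = toℕ x , mk≈ e

  square? : ∀ a → Dec (Square a)
  square? a with isSqMod? m a
  ... | yes s = yes (isSqMod⇒square s)
  ... | no ¬s = no (λ s → ¬s (square⇒isSqMod s))

  legendre-square : ∀ {a} → ¬ p ∣ a → Square a → legendre p a ≡ 1ℤ
  legendre-square {a} p∤a s with p ∣? a
  ... | yes p∣a = ⊥-elim (p∤a p∣a)
  ... | no _ with isSqMod? m a
  ...   | yes _ = refl
  ...   | no ¬s = ⊥-elim (¬s (square⇒isSqMod s))

  legendre-nonsquare : ∀ {a} → ¬ p ∣ a → ¬ Square a → legendre p a ≡ -1ℤ
  legendre-nonsquare {a} p∤a ¬s with p ∣? a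
  ... | yes p∣a = ⊥-elim (p∤a p∣a)
  ... | no _ with isSqMod? m a
  ...   | yes s = ⊥-elim (¬s (isSqMod⇒square s))
  ...   | no _ = refl

  square-injective-≤ : ∀ {x y} → x ≤ y → x + y < p → x * x ≈ y * y → x ≡ y
  square-injective-≤ {x} x≤y x+y<p x²≈y² with m≤n⇒∃[o]m+o≡n x≤y
  ... | d , refl with euclidsLemma d (x + (x + d)) prime p∣d[x+y]
    where
      square-+ : ∀ x d → (x + d) * (x + d) ≡ x * x + d * (x + (x + d))
      square-+ = solve-∀
      p∣d[x+y] : p ∣ d * (x + (x + d))
      p∣d[x+y] = +-≈⇒∣ (x * x) _ (≈-trans (≈-reflexive (sym (square-+ x d))) (≈-sym x²≈y²))
  ... | inj₁ p∣d = sym (trans (cong (λ t → x + t) d≡0) (+-identityʳ x))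
    where
      d≡0 : d ≡ 0
      d≡0 = ∣∧<⇒≡0 p∣d (≤-<-trans (≤-trans (m≤n+m d x) (m≤n+m (x + d) x)) x+y<p)
  ... | inj₂ p∣x+y = trans (m+n≡0⇒m≡0 x x+y≡0) (sym (m+n≡0⇒n≡0 x x+y≡0))
    where
      x+y≡0 : x + (x + d) ≡ 0
      x+y≡0 = ∣∧<⇒≡0 p∣x+y x+y<p

  square-injective : ∀ {x y} → x + y < p → x * x ≈ y * y → x ≡ y
  square-injective {x} {y} x+y<p x²≈y² with ≤-total x y
  ... | inj₁ x≤y = square-injective-≤ x≤y x+y<p x²≈y²
  ... | inj₂ y≤x = sym (square-injective-≤ y≤x (subst (_< p) (+-comm x y) x+y<p) (≈-sym x²≈y²))

  cross-square : ∀ {a b x y} → ¬ p ∣ y → a * (x * x) ≈ b * (y * y) → Square (a * b)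
  cross-square {a} {b} {x} {y} p∤y ax²≈by² =
    square-*-cancelˡ (∤-* p∤y p∤y) (y , ≈-refl) (a * x , (begin
      (a * x) * (a * x) ≡⟨ regroup a x ⟩
      a * (a * (x * x)) ≈⟨ *-cong (≈-refl {a}) ax²≈by² ⟩
      a * (b * (y * y)) ≡⟨ regroup′ a b y ⟩
      (y * y) * (a * b) ∎))
    where
      open import Relation.Binary.Reasoning.Setoid ≈-setoid
      regroup : ∀ a x → (a * x) * (a * x) ≡ a * (a * (x * x))
      regroup = solve-∀
      regroup′ : ∀ a b y → a * (b * (y * y)) ≡ (y * y) * (a * b)
      regroup′ = solve-∀

  module ThreeClasses {u v : ℕ} (p∤u : ¬ p ∣ u) (p∤v : ¬ p ∣ v)
           (u∉□ : ¬ Square u) (v∉□ : ¬ Square v) (uv∉□ : ¬ Square (u * v))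
           (h : ℕ) (h+h<p : h + h < p) where

    weight : Fin 3 → ℕ
    weight 0F = 1
    weight 1F = u
    weight 2F = u * v

    weight-∤ : ∀ c → ¬ p ∣ weight c
    weight-∤ 0F = p∤1
    weight-∤ 1F = p∤u
    weight-∤ 2F = ∤-* p∤u p∤v

    weights-apart : ∀ c c′ → Square (weight c * weight c′) → c ≡ c′
    weights-apart 0F 0F _ = refl
    weights-apart 0F 1F s = ⊥-elim (u∉□ (square-resp (≈-reflexive (*-identityˡ u)) s))
    weights-apart 0F 2F s = ⊥-elim (uv∉□ (square-resp (≈-reflexive (*-identityˡ (u * v))) s))
    weights-apart 1F 1F _ = refl
    weights-apart 1F 2F s = ⊥-elim (v∉□ (square-*-cancelˡ (∤-* p∤u p∤u) (u , ≈-refl)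
                              (square-resp (≈-reflexive (sym (*-assoc u u v))) s)))
    weights-apart 2F 2F _ = refl
    weights-apart 1F 0F s = sym (weights-apart 0F 1F (square-*-comm u 1 s))
    weights-apart 2F 0F s = sym (weights-apart 0F 2F (square-*-comm (u * v) 1 s))
    weights-apart 2F 1F s = sym (weights-apart 1F 2F (square-*-comm (u * v) u s))

    side : Fin h → ℕ
    side x = suc (toℕ x)

    side-∤ : ∀ x → ¬ p ∣ side x
    side-∤ x p∣x = 0≢1+n (sym (∣∧<⇒≡0 p∣x (≤-<-trans (≤-trans (toℕ<n x) (m≤m+n h h)) h+h<p)))

    value : Fin 3 × Fin h → ℕ
    value (c , x) = weight c * (side x * side x)

    value-∤ : ∀ s → ¬ p ∣ value s
    value-∤ (c , x) = ∤-* (weight-∤ c) (∤-* (side-∤ x) (side-∤ x))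

    class-injective : ∀ {c c′ x y} → weight c * (side x * side x) ≈ weight c′ * (side y * side y) → c ≡ c′
    class-injective {c} {c′} {x} {y} e =
      weights-apart c c′ (cross-square {weight c} {weight c′} {side x} {side y} (side-∤ y) e)

    side-injective : ∀ {c c′ x y} → c ≡ c′ →
                     weight c * (side x * side x) ≈ weight c′ * (side y * side y) → x ≡ y
    side-injective {c} {x = x} {y} refl e = toℕ-injective (suc-injective
      (square-injective {side x} {side y} side-sum (*-cancelˡ-≈ {weight c} (weight-∤ c) e)))
      where
        side-sum : side x + side y < p
        side-sum = ≤-<-trans (+-mono-≤ (toℕ<n x) (toℕ<n y)) h+h<p

    value-injective : ∀ {s t} → value s ≈ value t → s ≡ t
    value-injective {c , x} {c′ , y} e = cong₂ _,_ c≡c′ (side-injective {c} {c′} {x} {y} c≡c′ e)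
      where
        c≡c′ : c ≡ c′
        c≡c′ = class-injective {c} {c′} {x} {y} e

    residue : Fin (suc (3 * h)) → ℕ
    residue 0F = 0
    residue (fsuc j) = value (remQuot h j)

    residue-injective : ∀ {i j} → residue i ≈ residue j → i ≡ j
    residue-injective {0F}     {0F}     _ = refl
    residue-injective {0F}     {fsuc j} e = ⊥-elim (value-∤ (remQuot h j) (≈0⇒∣ (≈-sym e)))
    residue-injective {fsuc i} {0F}     e = ⊥-elim (value-∤ (remQuot h i) (≈0⇒∣ e))
    residue-injective {fsuc i} {fsuc j} e = cong fsuc (begin
      i                                ≡⟨ combine-remQuot {3} h i ⟨
      uncurry combine (remQuot h i)    ≡⟨ cong (uncurry combine) (value-injective {remQuot h i} {remQuot h j} e) ⟩
      uncurry combine (remQuot h j)    ≡⟨ combine-remQuot {3} h j ⟩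
      j                                ∎)
      where open ≡-Reasoning

    classes-bound : suc (3 * h) ≤ p
    classes-bound = incongruent⇒≤ residue residue-injective

  nonsquare-*-nonsquare : ¬ 2 ∣ p → ∀ {u v} → ¬ p ∣ u → ¬ p ∣ v →
                          ¬ Square u → ¬ Square v → Square (u * v)
  nonsquare-*-nonsquare odd {u} {v} p∤u p∤v u∉□ v∉□ with square? (u * v)
  ... | yes uv∈□ = uv∈□
  ... | no uv∉□ with odd⇒pred≡double odd
  ...   | h , m≡h+h = ⊥-elim (¬prime[1] (subst (λ n → Prime (suc n)) m≡0 prime))
    where
      open ThreeClasses p∤u p∤v u∉□ v∉□ uv∉□ h (subst (λ n → h + h < suc n) (sym m≡h+h) ≤-refl)
      m≡0 : m ≡ 0
      m≡0 = trans m≡h+h (cong (λ t → t + t)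
              (3*n≤n+n⇒n≡0 h (subst (3 * h ≤_) m≡h+h (≤-pred classes-bound))))

  legendre-unit : ∀ {a} → ¬ p ∣ a → IsUnit (legendre p a)
  legendre-unit {a} p∤a with square? a
  ... | yes a∈□ = inj₂ (legendre-square p∤a a∈□)
  ... | no a∉□ = inj₁ (legendre-nonsquare p∤a a∉□)

  legendre-* : ¬ 2 ∣ p → ∀ {a b} → ¬ p ∣ a → ¬ p ∣ b →
               legendre p (a * b) ≡ legendre p a ℤ.* legendre p b
  legendre-* odd {a} {b} p∤a p∤b = by-cases (square? a) (square? b)
    where
      p∤ab : ¬ p ∣ a * b
      p∤ab = ∤-* p∤a p∤b

      values : ∀ {s t} → legendre p a ≡ s → legendre p b ≡ t → legendre p (a * b) ≡ s ℤ.* t →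
               legendre p (a * b) ≡ legendre p a ℤ.* legendre p b
      values χa χb χab = trans χab (sym (cong₂ ℤ._*_ χa χb))

      by-cases : Dec (Square a) → Dec (Square b) → legendre p (a * b) ≡ legendre p a ℤ.* legendre p b
      by-cases (yes a∈□) (yes b∈□) =
        values (legendre-square p∤a a∈□) (legendre-square p∤b b∈□)
               (legendre-square p∤ab (square-* a∈□ b∈□))
      by-cases (yes a∈□) (no b∉□) =
        values (legendre-square p∤a a∈□) (legendre-nonsquare p∤b b∉□)
               (legendre-nonsquare p∤ab (b∉□ ∘ square-*-cancelˡ p∤a a∈□))
      by-cases (no a∉□) (yes b∈□) =
        values (legendre-nonsquare p∤a a∉□) (legendre-square p∤b b∈□)
               (legendre-nonsquare p∤ab (a∉□ ∘ square-*-cancelˡ p∤b b∈□ ∘ square-*-comm a b))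
      by-cases (no a∉□) (no b∉□) =
        values (legendre-nonsquare p∤a a∉□) (legendre-nonsquare p∤b b∉□)
               (legendre-square p∤ab (nonsquare-*-nonsquare odd p∤a p∤b a∉□ b∉□))

module OddPrimeModulus {m : ℕ} (prime : Prime (suc m)) (odd : ¬ 2 ∣ suc m) where

  open Congruence m
  open PrimeModulus prime

  prodOver-∤ : ∀ {k} (b : Fin k → ℕ) → (∀ i → ¬ p ∣ b i) → ∀ I → ¬ p ∣ prodOver b I
  prodOver-∤ b p∤b []          = p∤1
  prodOver-∤ b p∤b (true ∷ I)  = ∤-* (p∤b 0F) (prodOver-∤ (b ∘ fsuc) (p∤b ∘ fsuc) I)
  prodOver-∤ b p∤b (false ∷ I) = prodOver-∤ (b ∘ fsuc) (p∤b ∘ fsuc) I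

  legendre-prodOver : ∀ {k σ} (b : Fin k → ℕ) → (∀ i → ¬ p ∣ b i) → ∀ I →
                      (∀ i → i ∈ I → legendre p (b i) ≡ σ) → legendre p (prodOver b I) ≡ σ ℤ.^ ∣ I ∣
  legendre-prodOver b p∤b [] _ = legendre-square p∤1 (1 , ≈-refl)
  legendre-prodOver {σ = σ} b p∤b (true ∷ I) χ≡σ = begin
    legendre p (b 0F * prodOver (b ∘ fsuc) I)
      ≡⟨ legendre-* odd (p∤b 0F) (prodOver-∤ (b ∘ fsuc) (p∤b ∘ fsuc) I) ⟩
    legendre p (b 0F) ℤ.* legendre p (prodOver (b ∘ fsuc) I)
      ≡⟨ cong₂ ℤ._*_ (χ≡σ 0F here)
           (legendre-prodOver (b ∘ fsuc) (p∤b ∘ fsuc) I (λ i i∈I → χ≡σ (fsuc i) (there i∈I))) ⟩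
    σ ℤ.* σ ℤ.^ ∣ I ∣ ∎
    where open ≡-Reasoning
  legendre-prodOver b p∤b (false ∷ I) χ≡σ =
    legendre-prodOver (b ∘ fsuc) (p∤b ∘ fsuc) I (λ i i∈I → χ≡σ (fsuc i) (there i∈I))

  legendre-agrees-on-common-ratio :
    ∀ {k} (b : Fin k → ℕ) (S : Fin k → List ℕ) (n : ℕ) {ε : ℤ} → IsUnit ε → (∀ i → ¬ p ∣ b i) →
    (∀ a → Setup.InAP b S n a → ¬ p ∣ a) → (∀ a → Setup.InAP b S n a → legendre p a ≡ ε) →
    ∀ {r i j} → InScaled (b i) (S i) r → InScaled (b j) (S j) r → legendre p (b i) ≡ legendre p (b j)
  legendre-agrees-on-common-ratio b S n {ε} ε-unit p∤b AP-∤ χ≡ε {r} {i} {j}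
                                  (z , z∈ , rbᵢ≡z) (z′ , z′∈ , rbⱼ≡z′) =
    unit-cancelˡ ε-unit (begin
      ε ℤ.* legendre p (b i)             ≡⟨ ℤ.*-comm ε _ ⟩
      legendre p (b i) ℤ.* ε             ≡⟨ cong (legendre p (b i) ℤ.*_) (χ≡ε a′ a′∈AP) ⟨
      legendre p (b i) ℤ.* legendre p a′ ≡⟨ legendre-* odd (p∤b i) (AP-∤ a′ a′∈AP) ⟨
      legendre p (b i * a′)              ≡⟨ cong (legendre p) proportional ⟨
      legendre p (a * b j)               ≡⟨ legendre-* odd (AP-∤ a a∈AP) (p∤b j) ⟩
      legendre p a ℤ.* legendre p (b j)  ≡⟨ cong (ℤ._* legendre p (b j)) (χ≡ε a a∈AP) ⟩
      ε ℤ.* legendre p (b j)             ∎)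
    where
      open ≡-Reasoning
      a a′ : ℕ
      a = b i * n + z
      a′ = b j * n + z′
      a∈AP : Setup.InAP b S n a
      a∈AP = i , z , z∈ , refl
      a′∈AP : Setup.InAP b S n a′
      a′∈AP = j , z′ , z′∈ , refl
      proportional : a * b j ≡ b i * a′
      proportional = shift-proportional (b i) z (b j) z′ n
                       (common-ratio⇒cross {r} {b i} {z} {b j} {z′} rbᵢ≡z rbⱼ≡z′)

lemma9p7 : (k : ℕ) → 1 ≤ k →
    (b : Fin k → ℕ) → (∀ i → 0 < b i) → Injective _≡_ _≡_ b →
    (S : Fin k → List ℕ) → (∀ i → S i ≢ []) →
    ∃ (λ (I : Subset k) → Setup.InΛ b S I) →
    (ε : ℤ) → (ε ≡ -1ℤ ⊎ ε ≡ 1ℤ) →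
    (p : ℕ) → InΠminus b S p →
    ¬ (∃ λ (n : ℕ) → 1 ≤ n
         × (∀ a → Setup.InAP b S n a → 1 ≤ a × a ≤ p ∸ 1)
         × (∀ a → Setup.InAP b S n a → legendre p a ≡ ε))
lemma9p7 _ _ _ _ _ _ _ _ _ _ zero ((p-prime , _) , _) _ = ¬prime[0] p-prime
lemma9p7 _ _ b _ _ S _ _ ε ε-unit (suc m)
  ((p-prime , odd , p∤b) , I , (K , (_ , r , K-ratio , _) , I⊆K , (i₀ , i₀∈I) , 2∣∣I∣) , χ∏≡-1)
  (n , _ , range , χ≡ε) = -1≢1 (begin
    -1ℤ                          ≡⟨ χ∏≡-1 ⟨
    legendre p (prodOver b I)    ≡⟨ legendre-prodOver b p∤b I agrees-with-i₀ ⟩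
    legendre p (b i₀) ℤ.^ ∣ I ∣  ≡⟨ unit-even-power (legendre-unit (p∤b i₀)) 2∣∣I∣ ⟩
    1ℤ                           ∎)
  where
    open ≡-Reasoning
    open Congruence m
    open PrimeModulus p-prime
    open OddPrimeModulus p-prime odd

    -1≢1 : -1ℤ ≢ 1ℤ
    -1≢1 ()

    AP-∤ : ∀ a → Setup.InAP b S n a → ¬ p ∣ a
    AP-∤ a a∈AP p∣a with range a a∈AP
    ... | 1≤a , a≤m = <⇒≢ 1≤a (sym (∣∧<⇒≡0 p∣a (s≤s a≤m)))

    agrees-with-i₀ : ∀ i → i ∈ I → legendre p (b i) ≡ legendre p (b i₀)
    agrees-with-i₀ i i∈I = legendre-agrees-on-common-ratio b S n ε-unit p∤b AP-∤ χ≡ε {r} {i} {i₀}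
                             (K-ratio i (I⊆K i∈I)) (K-ratio i₀ (I⊆K i₀∈I))
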